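{- For every positive integer $n$, $N_{3n}(\mathbb{Z})\leq \frac{5n(n+1)}{2}$.
   Context: For a ring $R$, let $S(R):=\{a^{2} : a\in R\}$ denote the set of squares in $R$. For a subset $A\subseteq R$, the sumset is $A+A:=\{a+b : a,b\in A\}$. For a positive integer $n$, define $N_{n}(R):=\inf\{\,|A+A| : A\subseteq S(R),\ |A|=n\,\}$. -}

module Defs where

open import Data.Nat using (ℕ)
open import Data.Integer using (ℤ; _+_; _*_)
open import Data.List using (List; length)
open import Data.List.Membership.Propositional using (_∈_)
open import Data.List.Relation.Unary.All using (All)
open import Data.List.Relation.Unary.Unique.Propositional using (Unique)
open import Data.Product using (∃; ∃-syntax; _×_)
open import Function.Bundles using (_⇔_)
open import Relation.Binary.PropositionalEquality using (_≡_)
import Data.Nat as ℕ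

IsSquare : ℤ → Set
IsSquare x = ∃[ a ] x ≡ a * a

InSumset : List ℤ → ℤ → Set
InSumset A x = ∃[ a ] ∃[ b ] (a ∈ A × b ∈ A × x ≡ a + b)

Card : (ℤ → Set) → ℕ → Set
Card P m = ∃[ L ] (Unique L × length L ≡ m × (∀ x → (x ∈ L) ⇔ P x))

-- N_n(ℤ) ≤ k  (the infimum over a nonempty set of naturals is attained, so
-- this says: some n-element set of squares A has |A+A| ≤ k)
N≤ : ℕ → ℕ → Set
N≤ n k = ∃[ A ] (Unique A × length A ≡ n × All IsSquare A ×
                 ∃[ s ] (Card (InSumset A) s × s ℕ.≤ k))

-- If triples (aᵢ, bᵢ, cᵢ) all have their squares in arithmetic progression with one common
-- difference D, every element of A + A has the form aᵢ² + aⱼ² + kD with i ≤ j and 0 ≤ k ≤ 4,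
-- so |A + A| ≤ 5 · n(n + 1)/2. Such families exist for every n. Fibonacci's parametrisation
-- (p² − 2pq − q², p² + q², p² + 2pq − q²) is a square progression with difference
-- 4pq(p² − q²); for p = b², q = D, where (a, b, c) is a square progression with difference D,
-- that difference is 4b²D·a²c² = D(2abc)², and rescaling the old triples by 2abc moves them
-- to the same difference. The new triple is odd and the rescaled ones are even, which keeps
-- all 3n squares distinct.
module Submission where

open import Defs
open import Data.Nat as ℕ using (ℕ; zero; suc; s≤s; z≤n)
import Data.Nat.Properties as ℕ
open import Data.Nat.DivMod using (m*n/n≡m)
import Data.Nat.Tactic.RingSolver as ℕ-Solver
open import Data.Integer using (ℤ; +_; 0ℤ; _+_; _-_; _*_; NonZero; ≢-nonZero)
import Data.Integer.Properties as ℤ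
open import Data.Integer.Divisibility.Signed
  using (_∣_; divides; _∣?_; ∣-refl; ∣m∣n⇒∣m+n; ∣m∣n⇒∣m-n; ∣m⇒∣m*n; ∣n⇒∣m*n)
open import Data.Integer.Tactic.RingSolver using (solve-∀)
open import Data.List using (List; []; _∷_; _++_; map; length; upTo; filter; deduplicate; cartesianProductWith)
open import Data.List.Properties using (length-map; length-++; length-upTo; length-filter; length-deduplicate)
open import Data.List.Membership.Propositional using (_∈_; find; lose)
open import Data.List.Membership.Propositional.Properties
  using (∈-map⁺; ∈-++⁺ˡ; ∈-++⁺ʳ; ∈-upTo⁺; ∈-cartesianProductWith⁺; ∈-deduplicate⁺; ∈-filter⁺; ∈-filter⁻)
open import Data.List.Relation.Unary.Any as Any using (here; there)
open import Data.List.Relation.Unary.All as All using (All; []; _∷_)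
open import Data.List.Relation.Unary.All.Properties as All using ()
open import Data.List.Relation.Unary.Unique.Propositional using (Unique; []; _∷_)
open import Data.List.Relation.Unary.Unique.Propositional.Properties as Unique using ()
open import Data.List.Relation.Unary.Unique.DecPropositional.Properties using (deduplicate-!)
open import Data.List.Relation.Binary.Disjoint.Propositional using (Disjoint)
open import Data.Product using (∃-syntax; _×_; _,_; proj₂)
open import Data.Sum using ([_,_]′)
open import Function.Bundles using (mk⇔)
open import Relation.Nullary using (¬_)
open import Relation.Nullary.Decidable using (map′; from-no)
open import Relation.Unary using (Pred; Decidable; _⊆_)
open import Relation.Binary.PropositionalEquality

private
  variable
    x y d p q D l : ℤ
    xs : List ℤ

-- Parity

Even : ℤ → Set
Even x = + 2 ∣ x

record Odd (x : ℤ) : Set where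
  constructor odd
  field
    pred-even : Even (x - + 1)

odd+even⇒odd : Odd x → Even y → Odd (x + y)
odd+even⇒odd {x} {y} (odd ex) ey = odd (subst Even (regroup x y) (∣m∣n⇒∣m+n ex ey))
  where
  regroup : ∀ x y → x - + 1 + y ≡ x + y - + 1
  regroup = solve-∀

odd-even⇒odd : Odd x → Even y → Odd (x - y)
odd-even⇒odd {x} {y} (odd ex) ey = odd (subst Even (regroup x y) (∣m∣n⇒∣m-n ex ey))
  where
  regroup : ∀ x y → x - + 1 - y ≡ x - y - + 1
  regroup = solve-∀

odd*odd⇒odd : Odd x → Odd y → Odd (x * y)
odd*odd⇒odd {x} {y} (odd ex) (odd ey) = odd (subst Even (regroup x y) (∣m∣n⇒∣m+n (∣m⇒∣m*n y ex) ey))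
  where
  regroup : ∀ x y → (x - + 1) * y + (y - + 1) ≡ x * y - + 1
  regroup = solve-∀

odd⇒¬even : Odd x → ¬ Even x
odd⇒¬even {x} (odd ex) e = from-no (+ 2 ∣? + 1) (subst Even (difference x) (∣m∣n⇒∣m-n e ex))
  where
  difference : ∀ x → x - (x - + 1) ≡ + 1
  difference = solve-∀

odd⇒≢0 : Odd x → x ≢ 0ℤ
odd⇒≢0 ox refl = odd⇒¬even ox (divides 0ℤ refl)

odd-even-disjoint : ∀ {ys} → All Odd xs → All Even ys → Disjoint xs ys
odd-even-disjoint odds evens (v∈xs , v∈ys) = odd⇒¬even (All.lookup odds v∈xs) (All.lookup evens v∈ys)

*-≢0 : x ≢ 0ℤ → y ≢ 0ℤ → x * y ≢ 0ℤ
*-≢0 {x} x≢0 y≢0 xy≡0 = [ x≢0 , y≢0 ]′ (ℤ.i*j≡0⇒i≡0∨j≡0 x xy≡0)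

x≢x+d : d ≢ 0ℤ → x ≢ x + d
x≢x+d {d} {x} d≢0 x≡x+d = d≢0 (begin
  d           ≡⟨ cancel x d ⟩
  x + d - x   ≡⟨ cong (_- x) x≡x+d ⟨
  x - x       ≡⟨ ℤ.+-inverseʳ x ⟩
  0ℤ          ∎)
  where
  open ≡-Reasoning
  cancel : ∀ x d → d ≡ x + d - x
  cancel = solve-∀

-- Square progressions

Triple : Set
Triple = ℤ × ℤ × ℤ

SquareAP : ℤ → Triple → Set
SquareAP D (a , b , c) = b * b ≡ a * a + D × c * c ≡ b * b + D

squares : List Triple → List ℤ
squares [] = []
squares ((a , b , c) ∷ ts) = a * a ∷ b * b ∷ c * c ∷ squares ts

length-squares : ∀ ts → length (squares ts) ≡ 3 ℕ.* length ts
length-squares [] = refl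
length-squares (t ∷ ts) = begin
  3 ℕ.+ length (squares ts)  ≡⟨ cong (3 ℕ.+_) (length-squares ts) ⟩
  3 ℕ.+ 3 ℕ.* length ts      ≡⟨ ℕ.*-suc 3 (length ts) ⟨
  3 ℕ.* suc (length ts)      ∎
  where open ≡-Reasoning

squares-IsSquare : ∀ ts → All IsSquare (squares ts)
squares-IsSquare [] = []
squares-IsSquare ((a , b , c) ∷ ts) = (a , refl) ∷ (b , refl) ∷ (c , refl) ∷ squares-IsSquare ts

SquareAP-unique : ∀ {t} → D ≢ 0ℤ → SquareAP D t → Unique (squares (t ∷ []))
SquareAP-unique {D} {a , b , c} D≢0 (b²≡a²+D , c²≡b²+D) =
  (a²≢b² ∷ a²≢c² ∷ []) ∷ (b²≢c² ∷ []) ∷ [] ∷ []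
  where
  a²≢b² : a * a ≢ b * b
  a²≢b² a²≡b² = x≢x+d D≢0 (trans a²≡b² b²≡a²+D)
  b²≢c² : b * b ≢ c * c
  b²≢c² b²≡c² = x≢x+d D≢0 (trans b²≡c² c²≡b²+D)
  twice : ∀ x D → x + D + D ≡ x + + 2 * D
  twice = solve-∀
  a²≢c² : a * a ≢ c * c
  a²≢c² a²≡c² = x≢x+d (*-≢0 {+ 2} (λ ()) D≢0) (begin
    a * a          ≡⟨ a²≡c² ⟩
    c * c          ≡⟨ c²≡b²+D ⟩
    b * b + D      ≡⟨ cong (_+ D) b²≡a²+D ⟩
    a * a + D + D  ≡⟨ twice (a * a) D ⟩
    a * a + + 2 * D ∎)
    where open ≡-Reasoning

square-*-distrib : ∀ l x → (l * x) * (l * x) ≡ (l * l) * (x * x)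
square-*-distrib = solve-∀

scale : ℤ → Triple → Triple
scale l (a , b , c) = l * a , l * b , l * c

SquareAP-scale : ∀ {t} l → SquareAP D t → SquareAP (D * (l * l)) (scale l t)
SquareAP-scale {D} {a , b , c} l (b²≡a²+D , c²≡b²+D) = scaled a b b²≡a²+D , scaled b c c²≡b²+D
  where
  distribute : ∀ l x D → (l * l) * (x * x + D) ≡ (l * x) * (l * x) + D * (l * l)
  distribute = solve-∀
  scaled : ∀ x y → y * y ≡ x * x + D → (l * y) * (l * y) ≡ (l * x) * (l * x) + D * (l * l)
  scaled x y y²≡x²+D = begin
    (l * y) * (l * y)        ≡⟨ square-*-distrib l y ⟩
    (l * l) * (y * y)        ≡⟨ cong ((l * l) *_) y²≡x²+D ⟩
    (l * l) * (x * x + D)    ≡⟨ distribute l x D ⟩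
    (l * x) * (l * x) + D * (l * l) ∎
    where open ≡-Reasoning

squares-scale : ∀ l ts → squares (map (scale l) ts) ≡ map ((l * l) *_) (squares ts)
squares-scale l [] = refl
squares-scale l ((a , b , c) ∷ ts) =
  cong₂ _∷_ (square-*-distrib l a) (cong₂ _∷_ (square-*-distrib l b) (cong₂ _∷_ (square-*-distrib l c) (squares-scale l ts)))

-- Counting the sumset

shift : ℤ → ℤ → ℕ → ℤ
shift D v k = v + + k * D

shift-+ : ∀ D v w i j → shift D v i + shift D w j ≡ shift D (v + w) (i ℕ.+ j)
shift-+ D v w i j = begin
  v + + i * D + (w + + j * D)  ≡⟨ regroup v w (+ i) (+ j) D ⟩
  v + w + (+ i + + j) * D      ≡⟨ cong (λ n → v + w + n * D) (ℤ.pos-+ i j) ⟨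
  v + w + + (i ℕ.+ j) * D      ∎
  where
  open ≡-Reasoning
  regroup : ∀ v w i j D → v + i * D + (w + j * D) ≡ v + w + (i + j) * D
  regroup = solve-∀

baseSquares : List Triple → List ℤ
baseSquares = map λ { (a , _ , _) → a * a }

∈-squares⁻ : ∀ {ts} → All (SquareAP D) ts → x ∈ squares ts →
             ∃[ v ] ∃[ k ] v ∈ baseSquares ts × k ℕ.< 3 × x ≡ shift D v k
∈-squares⁻ {D} {ts = (a , _ , _) ∷ _} _ (here refl) = a * a , 0 , here refl , s≤s z≤n , no-shift (a * a) D
  where
  no-shift : ∀ v D → v ≡ v + + 0 * D
  no-shift = solve-∀
∈-squares⁻ {D} {ts = (a , _ , _) ∷ _} ((b²≡a²+D , _) ∷ _) (there (here refl)) =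
  a * a , 1 , here refl , s≤s (s≤s z≤n) , trans b²≡a²+D (one-shift (a * a) D)
  where
  one-shift : ∀ v D → v + D ≡ v + + 1 * D
  one-shift = solve-∀
∈-squares⁻ {D} {ts = (a , _ , _) ∷ _} ((b²≡a²+D , c²≡b²+D) ∷ _) (there (there (here refl))) =
  a * a , 2 , here refl , ℕ.≤-refl , trans c²≡b²+D (trans (cong (_+ D) b²≡a²+D) (two-shifts (a * a) D))
  where
  two-shifts : ∀ v D → v + D + D ≡ v + + 2 * D
  two-shifts = solve-∀
∈-squares⁻ (_ ∷ aps) (there (there (there x∈ts))) with ∈-squares⁻ aps x∈ts
... | v , k , v∈ts , k<3 , x≡ = v , k , there v∈ts , k<3 , x≡

pairSums : List ℤ → List ℤ
pairSums [] = []
pairSums (x ∷ xs) = map (_+_ x) (x ∷ xs) ++ pairSums xs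

∈-pairSums⁺ : ∀ {v w} → v ∈ xs → w ∈ xs → v + w ∈ pairSums xs
∈-pairSums⁺ {x ∷ xs} (here refl) w∈ = ∈-++⁺ˡ (∈-map⁺ (_+_ x) w∈)
∈-pairSums⁺ {x ∷ xs} {v} (there v∈) (here refl) =
  subst (_∈ pairSums (x ∷ xs)) (ℤ.+-comm x v) (∈-++⁺ˡ (∈-map⁺ (_+_ x) (there v∈)))
∈-pairSums⁺ {x ∷ xs} (there v∈) (there w∈) = ∈-++⁺ʳ (map (_+_ x) (x ∷ xs)) (∈-pairSums⁺ v∈ w∈)

triangle : ℕ → ℕ
triangle zero = 0
triangle (suc n) = suc n ℕ.+ triangle n

length-pairSums : ∀ xs → length (pairSums xs) ≡ triangle (length xs)
length-pairSums [] = refl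
length-pairSums (x ∷ xs) = begin
  length (map (_+_ x) (x ∷ xs) ++ pairSums xs)            ≡⟨ length-++ (map (_+_ x) (x ∷ xs)) ⟩
  length (map (_+_ x) (x ∷ xs)) ℕ.+ length (pairSums xs)  ≡⟨ cong₂ ℕ._+_ (length-map (_+_ x) (x ∷ xs)) (length-pairSums xs) ⟩
  suc (length xs) ℕ.+ triangle (length xs)               ∎
  where open ≡-Reasoning

triangle*2 : ∀ n → triangle n ℕ.* 2 ≡ n ℕ.* (n ℕ.+ 1)
triangle*2 zero = refl
triangle*2 (suc n) = begin
  (suc n ℕ.+ triangle n) ℕ.* 2        ≡⟨ ℕ.*-distribʳ-+ 2 (suc n) (triangle n) ⟩
  suc n ℕ.* 2 ℕ.+ triangle n ℕ.* 2    ≡⟨ cong (suc n ℕ.* 2 ℕ.+_) (triangle*2 n) ⟩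
  suc n ℕ.* 2 ℕ.+ n ℕ.* (n ℕ.+ 1)     ≡⟨ expand n ⟩
  suc n ℕ.* (suc n ℕ.+ 1)             ∎
  where
  open ≡-Reasoning
  expand : ∀ n → suc n ℕ.* 2 ℕ.+ n ℕ.* (n ℕ.+ 1) ≡ suc n ℕ.* (suc n ℕ.+ 1)
  expand = ℕ-Solver.solve-∀

triangle*5 : ∀ n → triangle n ℕ.* 5 ≡ (5 ℕ.* n ℕ.* (n ℕ.+ 1)) ℕ./ 2
triangle*5 n = sym (begin
  (5 ℕ.* n ℕ.* (n ℕ.+ 1)) ℕ./ 2         ≡⟨ cong (ℕ._/ 2) (ℕ.*-assoc 5 n (n ℕ.+ 1)) ⟩
  (5 ℕ.* (n ℕ.* (n ℕ.+ 1))) ℕ./ 2       ≡⟨ cong (λ k → (5 ℕ.* k) ℕ./ 2) (triangle*2 n) ⟨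
  (5 ℕ.* (triangle n ℕ.* 2)) ℕ./ 2      ≡⟨ cong (ℕ._/ 2) (regroup (triangle n)) ⟩
  (triangle n ℕ.* 5 ℕ.* 2) ℕ./ 2        ≡⟨ m*n/n≡m (triangle n ℕ.* 5) 2 ⟩
  triangle n ℕ.* 5                      ∎)
  where
  open ≡-Reasoning
  regroup : ∀ t → 5 ℕ.* (t ℕ.* 2) ≡ t ℕ.* 5 ℕ.* 2
  regroup = ℕ-Solver.solve-∀

length-cartesianProductWith : ∀ {A B C : Set} (f : A → B → C) xs ys →
                              length (cartesianProductWith f xs ys) ≡ length xs ℕ.* length ys
length-cartesianProductWith f [] ys = refl
length-cartesianProductWith f (x ∷ xs) ys = begin
  length (map (f x) ys ++ cartesianProductWith f xs ys)            ≡⟨ length-++ (map (f x) ys) ⟩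
  length (map (f x) ys) ℕ.+ length (cartesianProductWith f xs ys)  ≡⟨ cong₂ ℕ._+_ (length-map (f x) ys) (length-cartesianProductWith f xs ys) ⟩
  length ys ℕ.+ length xs ℕ.* length ys                            ∎
  where open ≡-Reasoning

sumsetCandidates : ℤ → List Triple → List ℤ
sumsetCandidates D ts = cartesianProductWith (shift D) (pairSums (baseSquares ts)) (upTo 5)

length-sumsetCandidates : ∀ D ts → length (sumsetCandidates D ts) ≡ triangle (length ts) ℕ.* 5
length-sumsetCandidates D ts = begin
  length (sumsetCandidates D ts)                          ≡⟨ length-cartesianProductWith (shift D) (pairSums (baseSquares ts)) (upTo 5) ⟩
  length (pairSums (baseSquares ts)) ℕ.* length (upTo 5)  ≡⟨ cong₂ ℕ._*_ (length-pairSums (baseSquares ts)) (length-upTo 5) ⟩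
  triangle (length (baseSquares ts)) ℕ.* 5                ≡⟨ cong (λ n → triangle n ℕ.* 5) (length-map _ ts) ⟩
  triangle (length ts) ℕ.* 5                              ∎
  where open ≡-Reasoning

sumset⊆sumsetCandidates : ∀ {ts} → All (SquareAP D) ts → InSumset (squares ts) ⊆ (_∈ sumsetCandidates D ts)
sumset⊆sumsetCandidates {D} aps (x , y , x∈ , y∈ , refl)
  with ∈-squares⁻ aps x∈ | ∈-squares⁻ aps y∈
... | v , i , v∈ , i<3 , refl | w , j , w∈ , j<3 , refl =
  subst (_∈ _) (sym (shift-+ D v w i j))
    (∈-cartesianProductWith⁺ (shift D) (∈-pairSums⁺ v∈ w∈) (∈-upTo⁺ (ℕ.+-mono-≤ i<3 (ℕ.<⇒≤pred j<3))))

InSumset? : ∀ A → Decidable (InSumset A)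
InSumset? A x = map′ fromAny toAny (Any.any? (λ a → Any.any? (λ b → x ℤ.≟ a + b) A) A)
  where
  fromAny : Any.Any (λ a → Any.Any (λ b → x ≡ a + b) A) A → InSumset A x
  fromAny sum with a , a∈ , sum′ ← find sum with b , b∈ , x≡a+b ← find sum′ = a , b , a∈ , b∈ , x≡a+b
  toAny : InSumset A x → Any.Any (λ a → Any.Any (λ b → x ≡ a + b) A) A
  toAny (a , b , a∈ , b∈ , x≡a+b) = lose a∈ (lose b∈ x≡a+b)

card-≤-length : ∀ {P : Pred ℤ _} → Decidable P → ∀ M → P ⊆ (_∈ M) → ∃[ s ] Card P s × s ℕ.≤ length M
card-≤-length P? M P⊆M =
  length L ,
  (L , Unique.filter⁺ P? (deduplicate-! ℤ._≟_ M) , refl ,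
   λ x → mk⇔ (λ x∈L → proj₂ (∈-filter⁻ P? {xs = deduplicate ℤ._≟_ M} x∈L)) (λ Px → ∈-filter⁺ P? (∈-deduplicate⁺ ℤ._≟_ (P⊆M Px)) Px)) ,
  ℕ.≤-trans (length-filter P? (deduplicate ℤ._≟_ M)) (length-deduplicate ℤ._≟_ M)
  where
  L : List ℤ
  L = filter P? (deduplicate ℤ._≟_ M)

sumset-squares-card : ∀ {ts} → All (SquareAP D) ts →
                      ∃[ s ] Card (InSumset (squares ts)) s × s ℕ.≤ triangle (length ts) ℕ.* 5
sumset-squares-card {D} {ts} aps
  with s , card , s≤ ← card-≤-length (InSumset? (squares ts)) (sumsetCandidates D ts) (sumset⊆sumsetCandidates aps) =
  s , card , ℕ.≤-trans s≤ (ℕ.≤-reflexive (length-sumsetCandidates D ts))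

-- Fibonacci's parametrisation

fibonacciTriple : ℤ → ℤ → Triple
fibonacciTriple p q = p * p - q * q - + 2 * p * q , p * p + q * q , p * p - q * q + + 2 * p * q

SquareAP-fibonacci : ∀ p q → SquareAP (+ 4 * p * q * (p * p - q * q)) (fibonacciTriple p q)
SquareAP-fibonacci p q = lower p q , upper p q
  where
  lower : ∀ p q → (p * p + q * q) * (p * p + q * q)
                ≡ (p * p - q * q - + 2 * p * q) * (p * p - q * q - + 2 * p * q) + + 4 * p * q * (p * p - q * q)
  lower = solve-∀
  upper : ∀ p q → (p * p - q * q + + 2 * p * q) * (p * p - q * q + + 2 * p * q)
                ≡ (p * p + q * q) * (p * p + q * q) + + 4 * p * q * (p * p - q * q)
  upper = solve-∀

OddTriple : Triple → Set
OddTriple (a , b , c) = Odd a × Odd b × Odd c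

OddTriple⇒odd-squares : ∀ {t} → OddTriple t → All Odd (squares (t ∷ []))
OddTriple⇒odd-squares (oa , ob , oc) = odd*odd⇒odd oa oa ∷ odd*odd⇒odd ob ob ∷ odd*odd⇒odd oc oc ∷ []

fibonacci-odd : Odd p → Even q → OddTriple (fibonacciTriple p q)
fibonacci-odd {p} {q} op eq = first , middle , last
  where
  p² : Odd (p * p)
  p² = odd*odd⇒odd op op
  q² : Even (q * q)
  q² = ∣m⇒∣m*n q eq
  p²-q² : Odd (p * p - q * q)
  p²-q² = odd-even⇒odd p² q²
  2pq : Even (+ 2 * p * q)
  2pq = ∣n⇒∣m*n (+ 2 * p) eq
  first : Odd (p * p - q * q - + 2 * p * q)
  first = odd-even⇒odd p²-q² 2pq
  middle : Odd (p * p + q * q)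
  middle = odd+even⇒odd p² q²
  last : Odd (p * p - q * q + + 2 * p * q)
  last = odd+even⇒odd p²-q² 2pq

multiplier : Triple → ℤ
multiplier (a , b , c) = + 2 * a * b * c

multiplier-even : ∀ t → Even (multiplier t)
multiplier-even (a , b , c) = ∣m⇒∣m*n c (∣m⇒∣m*n b (∣m⇒∣m*n a ∣-refl))

multiplier-≢0 : ∀ {t} → OddTriple t → multiplier t ≢ 0ℤ
multiplier-≢0 (oa , ob , oc) = *-≢0 (*-≢0 (*-≢0 {+ 2} (λ ()) (odd⇒≢0 oa)) (odd⇒≢0 ob)) (odd⇒≢0 oc)

next : ℤ → Triple → Triple
next D (a , b , c) = fibonacciTriple (b * b) D

next-difference : ∀ {a b c} → SquareAP D (a , b , c) →
                  + 4 * (b * b) * D * ((b * b) * (b * b) - D * D) ≡ D * (multiplier (a , b , c) * multiplier (a , b , c))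
next-difference {D} {a} {b} {c} (b²≡a²+D , c²≡b²+D) = begin
  + 4 * b² * D * (b² * b² - D * D)       ≡⟨ factor b² D ⟩
  + 4 * b² * D * (b² - D) * (b² + D)     ≡⟨ cong₂ (λ u v → + 4 * b² * D * u * v) b²-D≡a² (sym c²≡b²+D) ⟩
  + 4 * b² * D * (a * a) * (c * c)       ≡⟨ regroup a b c D ⟩
  D * (multiplier (a , b , c) * multiplier (a , b , c)) ∎
  where
  open ≡-Reasoning
  b² : ℤ
  b² = b * b
  factor : ∀ p D → + 4 * p * D * (p * p - D * D) ≡ + 4 * p * D * (p - D) * (p + D)
  factor = solve-∀
  regroup : ∀ a b c D → + 4 * (b * b) * D * (a * a) * (c * c) ≡ D * ((+ 2 * a * b * c) * (+ 2 * a * b * c))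
  regroup = solve-∀
  cancel : ∀ x D → x + D - D ≡ x
  cancel = solve-∀
  b²-D≡a² : b² - D ≡ a * a
  b²-D≡a² = trans (cong (_- D) b²≡a²+D) (cancel (a * a) D)

SquareAP-next : ∀ {t} → SquareAP D t → SquareAP (D * (multiplier t * multiplier t)) (next D t)
SquareAP-next {D} {a , b , c} ap =
  subst (λ E → SquareAP E (next D (a , b , c))) (next-difference {a = a} {b = b} {c = c} ap) (SquareAP-fibonacci (b * b) D)

next-odd : ∀ {t} → OddTriple t → Even D → OddTriple (next D t)
next-odd {t = _ , b , _} (_ , ob , _) eD = fibonacci-odd (odd*odd⇒odd ob ob) eD

scaled-squares-unique : ∀ {ts} → l ≢ 0ℤ → Unique (squares ts) → Unique (squares (map (scale l) ts))
scaled-squares-unique {l} {ts} l≢0 unique =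
  subst Unique (sym (squares-scale l ts)) (Unique.map⁺ (ℤ.*-cancelˡ-≡ (l * l) _ _) unique)
  where
  instance
    l²≢0 : NonZero (l * l)
    l²≢0 = ≢-nonZero (*-≢0 l≢0 l≢0)

scaled-squares-even : ∀ ts → Even l → All Even (squares (map (scale l) ts))
scaled-squares-even {l} ts el =
  subst (All Even) (sym (squares-scale l ts)) (All.map⁺ (All.universal (λ x → ∣m⇒∣m*n x (∣m⇒∣m*n l el)) _))

record Chain : Set where
  constructor chain
  field
    difference : ℤ
    top : Triple
    rest : List Triple

  triples : List Triple
  triples = top ∷ rest

grow : Chain → Chain
grow (chain D t ts) = chain (D * (multiplier t * multiplier t)) (next D t) (map (scale (multiplier t)) (t ∷ ts))

build : ℕ → Chain
build zero = chain (+ 24) (+ 1 , + 5 , + 7) []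
build (suc m) = grow (build m)

length-build : ∀ m → length (Chain.triples (build m)) ≡ suc m
length-build zero = refl
length-build (suc m) with build m | length-build m
... | chain D t ts | len = cong suc (trans (length-map (scale (multiplier t)) (t ∷ ts)) len)

record Valid (C : Chain) : Set where
  open Chain C
  field
    progressions : All (SquareAP difference) triples
    top-odd : OddTriple top
    difference-even : Even difference
    difference≢0 : difference ≢ 0ℤ
    squares-unique : Unique (squares triples)

valid-grow : ∀ C → Valid C → Valid (grow C)
valid-grow (chain D t@(_ , _ , _) ts) v = record
  { progressions = ap′ ∷ All.map⁺ (All.map (SquareAP-scale k) progressions)
  ; top-odd = top-odd′
  ; difference-even = ∣m⇒∣m*n (k * k) difference-even
  ; difference≢0 = D′≢0
  ; squares-unique = Unique.++⁺ {xs = squares (next D t ∷ [])} top-unique (scaled-squares-unique k≢0 squares-unique)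
                      (odd-even-disjoint (OddTriple⇒odd-squares top-odd′) (scaled-squares-even (t ∷ ts) (multiplier-even t)))
  }
  where
  open Valid v
  k : ℤ
  k = multiplier t
  k≢0 : k ≢ 0ℤ
  k≢0 = multiplier-≢0 top-odd
  D′≢0 : D * (k * k) ≢ 0ℤ
  D′≢0 = *-≢0 difference≢0 (*-≢0 k≢0 k≢0)
  ap′ : SquareAP (D * (k * k)) (next D t)
  ap′ = SquareAP-next {t = t} (All.head progressions)
  top-odd′ : OddTriple (next D t)
  top-odd′ = next-odd {t = t} top-odd difference-even
  top-unique : Unique (squares (next D t ∷ []))
  top-unique = SquareAP-unique {t = next D t} D′≢0 ap′

valid-build : ∀ m → Valid (build m)
valid-build zero = record
  { progressions = (refl , refl) ∷ []
  ; top-odd = odd (divides 0ℤ refl) , odd (divides (+ 2) refl) , odd (divides (+ 3) refl)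
  ; difference-even = divides (+ 12) refl
  ; difference≢0 = λ ()
  ; squares-unique = ((λ ()) ∷ (λ ()) ∷ []) ∷ ((λ ()) ∷ []) ∷ [] ∷ []
  }
valid-build (suc m) = valid-grow (build m) (valid-build m)

mainTheorem6 : (n : ℕ) → 1 ℕ.≤ n → N≤ (3 ℕ.* n) ((5 ℕ.* n ℕ.* (n ℕ.+ 1)) ℕ./ 2)
mainTheorem6 (suc m) _
  with s , card , s≤ ← sumset-squares-card (Valid.progressions (valid-build m)) =
  squares ts , Valid.squares-unique (valid-build m) ,
  trans (length-squares ts) (cong (3 ℕ.*_) (length-build m)) , squares-IsSquare ts ,
  s , card , ℕ.≤-trans s≤ (ℕ.≤-reflexive bound)
  where
  ts : List Triple
  ts = Chain.triples (build m)
  bound : triangle (length ts) ℕ.* 5 ≡ (5 ℕ.* suc m ℕ.* (suc m ℕ.+ 1)) ℕ./ 2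
  bound = trans (cong (λ n → triangle n ℕ.* 5) (length-build m)) (triangle*5 (suc m))
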